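{- Let $G=(V,E)$ be a simple undirected graph (the vertex set $V$ is not assumed finite). If $G$ admits a graph derangement, then $G$ admits a surjective graph derangement.
   Context: Write $x\sim y$ if $\{x,y\}\in E$. A graph derangement of $G$ is an injective map $f:V\to V$ with $f(v)\sim v$ for all $v\in V$; it is surjective if it is surjective as a map $V\to V$ (equivalently, a bijection of $V$). -}

module Defs where

open import Data.Product using (Σ; _×_)
open import Relation.Nullary using (¬_)
open import Relation.Binary.PropositionalEquality using (_≡_)
open import Function.Definitions using (Injective; Surjective)

record SimpleGraph (V : Set) : Set₁ where
  field
    _∼_   : V → V → Set
    sym   : ∀ {x y} → x ∼ y → y ∼ x
    irrefl : ∀ {x} → ¬ (x ∼ x)

open SimpleGraph public

IsGraphDerangement : {V : Set} → SimpleGraph V → (V → V) → Set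
IsGraphDerangement G f = Injective _≡_ _≡_ f × (∀ v → _∼_ G (f v) v)

IsSurjectiveGraphDerangement : {V : Set} → SimpleGraph V → (V → V) → Set
IsSurjectiveGraphDerangement G f = IsGraphDerangement G f × Surjective _≡_ _≡_ f

AdmitsGraphDerangement : {V : Set} → SimpleGraph V → Set
AdmitsGraphDerangement {V} G = Σ (V → V) (IsGraphDerangement G)

AdmitsSurjectiveGraphDerangement : {V : Set} → SimpleGraph V → Set
AdmitsSurjectiveGraphDerangement {V} G = Σ (V → V) (IsSurjectiveGraphDerangement G)

-- A vertex outside the image of f starts a one-sided chain
-- s, f s, f² s, …; reversing every second arrow of each such chain (swapping f²ᵏ s
-- with f²ᵏ⁺¹ s) leaves every vertex matched to a neighbour, and, with f kept on all
-- the remaining orbits (cycles and two-sided chains), the result is a bijection.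
module Submission where

open import Defs
  using (SimpleGraph; _∼_; AdmitsGraphDerangement; AdmitsSurjectiveGraphDerangement)
open import Level using (0ℓ)
open import Axiom.ExcludedMiddle using (ExcludedMiddle)
open import Data.Nat using (ℕ; zero; suc)
open import Data.Product using (Σ; ∃; _×_; _,_)
open import Data.Sum using (_⊎_; inj₁; inj₂)
open import Data.Empty using (⊥-elim)
open import Function.Definitions using (Injective; Surjective; StrictlySurjective)
open import Function.Consequences.Propositional using (strictlySurjective⇒surjective)
open import Relation.Nullary using (¬_; Dec; yes; no)
open import Relation.Binary.PropositionalEquality
  using (_≡_; refl; sym; trans; cong; subst)

module Interleaving (lem : ExcludedMiddle 0ℓ) {V : Set} (f : V → V)
                    (f-injective : Injective _≡_ _≡_ f) where

  evenIterate : ℕ → V → V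
  evenIterate zero    s = s
  evenIterate (suc k) s = f (f (evenIterate k s))

  IsSource : V → Set
  IsSource s = ¬ ∃ λ w → f w ≡ s

  Even : V → Set
  Even u = ∃ λ k → ∃ λ s → IsSource s × evenIterate k s ≡ u

  Odd : V → Set
  Odd v = ∃ λ u → f u ≡ v × Even u

  Even-pred⇒Odd : ∀ {u b} → Even u → u ≡ f b → Odd b
  Even-pred⇒Odd {b = b} (zero , s , source , s≡u) u≡fb =
    ⊥-elim (source (b , sym (trans s≡u u≡fb)))
  Even-pred⇒Odd (suc k , s , source , eq) u≡fb =
    evenIterate k s , f-injective (trans eq u≡fb) , k , s , source , refl

  Odd⇒Even-succ : ∀ {w} → Odd w → Even (f w)
  Odd⇒Even-succ (u , refl , k , s , source , refl) = suc k , s , source , refl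

  ¬Even⇒image : ∀ {y} → ¬ Even y → ∃ λ w → f w ≡ y
  ¬Even⇒image {y} ¬even with lem {∃ λ w → f w ≡ y}
  ... | yes image = image
  ... | no source = ⊥-elim (¬even (zero , y , source , refl))

  select : (v : V) → Dec (Odd v) → V
  select v (yes (u , _)) = u
  select v (no _)        = f v

  g : V → V
  g v = select v lem

  select-interleaves : ∀ v d → select v d ≡ f v ⊎ f (select v d) ≡ v
  select-interleaves v (yes (u , fu≡v , _)) = inj₂ fu≡v
  select-interleaves v (no _)               = inj₁ refl

  select-injective : ∀ a b da db → select a da ≡ select b db → a ≡ b
  select-injective a b (yes (u , fu≡a , _)) (yes (u′ , fu′≡b , _)) u≡u′ =
    trans (sym fu≡a) (trans (cong f u≡u′) fu′≡b)
  select-injective a b (yes (u , _ , even)) (no ¬odd) u≡fb =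
    ⊥-elim (¬odd (Even-pred⇒Odd even u≡fb))
  select-injective a b (no ¬odd) (yes (u , _ , even)) fa≡u =
    ⊥-elim (¬odd (Even-pred⇒Odd even (sym fa≡u)))
  select-injective a b (no _) (no _) fa≡fb = f-injective fa≡fb

  g-injective : Injective _≡_ _≡_ g
  g-injective {a} {b} = select-injective a b lem lem

  select-succ-of-Even : ∀ {y} → Even y → (d : Dec (Odd (f y))) → select (f y) d ≡ y
  select-succ-of-Even even (yes (u , fu≡fy , _)) = f-injective fu≡fy
  select-succ-of-Even {y} even (no ¬odd)         = ⊥-elim (¬odd (y , refl , even))

  select-pred-of-¬Even : ∀ {y w} → ¬ Even y → f w ≡ y → (d : Dec (Odd w)) → select w d ≡ y
  select-pred-of-¬Even ¬even fw≡y (yes odd) =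
    ⊥-elim (¬even (subst Even fw≡y (Odd⇒Even-succ odd)))
  select-pred-of-¬Even ¬even fw≡y (no _)    = fw≡y

  g-strictlySurjective : StrictlySurjective _≡_ g
  g-strictlySurjective y with lem {Even y}
  ... | yes even  = f y , select-succ-of-Even even lem
  ... | no ¬even  with ¬Even⇒image ¬even
  ...   | w , fw≡y = w , select-pred-of-¬Even ¬even fw≡y lem

injection-interleavedByBijection :
  ExcludedMiddle 0ℓ → {V : Set} (f : V → V) → Injective _≡_ _≡_ f →
  Σ (V → V) λ g → Injective _≡_ _≡_ g × Surjective _≡_ _≡_ g ×
                  (∀ v → g v ≡ f v ⊎ f (g v) ≡ v)
injection-interleavedByBijection lem f f-injective =
  g , g-injective , strictlySurjective⇒surjective g-strictlySurjective ,
  λ v → select-interleaves v lem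
  where open Interleaving lem f f-injective

proposition2 : ExcludedMiddle 0ℓ → (V : Set) → (G : SimpleGraph V) →
    AdmitsGraphDerangement G → AdmitsSurjectiveGraphDerangement G
proposition2 lem V G (f , f-injective , f-adjacent)
  with injection-interleavedByBijection lem f f-injective
... | g , g-injective , g-surjective , interleaves =
  g , (g-injective , g-adjacent) , g-surjective
  where
  g-adjacent : ∀ v → _∼_ G (g v) v
  g-adjacent v with interleaves v
  ... | inj₁ gv≡fv  = subst (λ x → _∼_ G x v) (sym gv≡fv) (f-adjacent v)
  ... | inj₂ fgv≡v = subst (_∼_ G (g v)) fgv≡v (SimpleGraph.sym G (f-adjacent (g v)))
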